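{- Let $\mathcal{S}=(E,\mathcal{I})$ be an $r$-covering system with set of bases $\mathcal{B}$ and activity $\texttt{a}$. Let $\mathcal{B}'\subseteq\mathcal{B}$ be nonempty and let $$\mathcal{I}'=\{I\in\mathcal{I} : \text{there exists } B\in\mathcal{B}' \text{ with } B\setminus\texttt{a}(B)\subseteq I\subseteq B\}.$$ Then $\mathcal{S}'=(E,\mathcal{I}')$ is an $r$-covering system and the restriction $\texttt{a}'=\texttt{a}|_{\mathcal{B}'}$ is an activity of $\mathcal{S}'$.
   Context: For finite sets $X\subseteq Y$, write $[X,Y]=\{Z : X\subseteq Z\subseteq Y\}$. An $r$-covering system is a pair $\mathcal{S}=(E,\mathcal{I})$ with $E$ a finite set and $\mathcal{I}$ a collection of subsets of $E$, each of cardinality at most $r$, such that for every $I\in\mathcal{I}$ there is an $r$-element set $B\in\mathcal{I}$ with $[I,B]\subseteq\mathcal{I}$. The $r$-element sets in $\mathcal{I}$ are called bases. An activity of a covering system with set of bases $\mathcal{B}$ and independent sets $\mathcal{I}$ is a function $\texttt{a}:\mathcal{B}\to 2^E$ with $\texttt{a}(B)\subseteq B$, $[B\setminus\texttt{a}(B),B]\subseteq\mathcal{I}$ for all $B\in\mathcal{B}$, and such that every $I\in\mathcal{I}$ lies in $[B\setminus\texttt{a}(B),B]$ for exactly one $B\in\mathcal{B}$. -}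

module Defs where

open import Data.Nat using (ℕ; _≤_)
open import Data.Fin.Subset using (Subset; _⊆_; _─_; ∣_∣)
open import Data.Product using (Σ; _×_; ∃; ∃-syntax)
open import Relation.Binary.PropositionalEquality using (_≡_)

-- Ground set E = Fin n; subsets of E are  Subset n.
-- A collection of subsets of E is a predicate on  Subset n.
Collection : ℕ → Set₁
Collection n = Subset n → Set

IntervalIn : {n : ℕ} → Collection n → Subset n → Subset n → Set
IntervalIn 𝓘 X Y = ∀ Z → X ⊆ Z → Z ⊆ Y → 𝓘 Z

IsBase : {n : ℕ} → ℕ → Collection n → Subset n → Set
IsBase r 𝓘 B = 𝓘 B × ∣ B ∣ ≡ r

IsCoveringSystem : {n : ℕ} → ℕ → Collection n → Set
IsCoveringSystem {n} r 𝓘 =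
  (∀ I → 𝓘 I → ∣ I ∣ ≤ r) ×
  (∀ I → 𝓘 I → ∃[ B ] (IsBase r 𝓘 B × I ⊆ B × IntervalIn 𝓘 I B))

-- a : 𝓑 → 2^E is an activity.  The function is given as a total function
-- on subsets; only its values on bases matter.
IsActivity : {n : ℕ} → ℕ → Collection n → (Subset n → Subset n) → Set
IsActivity {n} r 𝓘 a =
  (∀ B → IsBase r 𝓘 B → a B ⊆ B × IntervalIn 𝓘 (B ─ a B) B) ×
  (∀ I → 𝓘 I →
     Σ (Subset n) λ B → (IsBase r 𝓘 B × B ─ a B ⊆ I × I ⊆ B) ×
       (∀ B′ → IsBase r 𝓘 B′ → B′ ─ a B′ ⊆ I → I ⊆ B′ → B′ ≡ B))

restrictColl : {n : ℕ} → Collection n → (Subset n → Subset n) →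
               Collection n → Collection n
restrictColl 𝓘 a 𝓑′ I = 𝓘 I × ∃[ B ] (𝓑′ B × B ─ a B ⊆ I × I ⊆ B)

-- An independent set of 𝓘′ lies in the interval of some B ∈ 𝓑′, and by uniqueness of the
-- activity interval in 𝓘 the bases of 𝓘′ are exactly the elements of 𝓑′ (a base B of 𝓘′
-- lies both in its own interval and in that of some element of 𝓑′). Hence the intervals
-- [B ∖ a(B), B] with B ∈ 𝓑′ cover 𝓘′, lie inside it, and partition it.
module Submission where

open import Defs
open import Data.Nat using (ℕ)
open import Data.Fin.Subset using (Subset; _⊆_; _─_)
open import Data.Fin.Subset.Properties using (⊆-refl; ⊆-trans; p─q⊆p)
open import Data.Product using (_×_; ∃-syntax; _,_; proj₁; proj₂)
open import Relation.Binary.PropositionalEquality using (_≡_; sym; trans; subst)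

activity-interval-unique :
  ∀ {n r} {𝓘 : Collection n} {a : Subset n → Subset n} → IsActivity r 𝓘 a →
  ∀ {I B₁ B₂} → 𝓘 I →
  IsBase r 𝓘 B₁ → B₁ ─ a B₁ ⊆ I → I ⊆ B₁ →
  IsBase r 𝓘 B₂ → B₂ ─ a B₂ ⊆ I → I ⊆ B₂ → B₁ ≡ B₂
activity-interval-unique (_ , partition) {I} I∈𝓘 b₁ l₁ h₁ b₂ l₂ h₂ =
  trans (unique _ b₁ l₁ h₁) (sym (unique _ b₂ l₂ h₂))
  where unique = proj₂ (proj₂ (partition I I∈𝓘))

module _ {n r : ℕ} {𝓘 : Collection n} {a : Subset n → Subset n}
         (activity : IsActivity r 𝓘 a)
         (𝓑′ : Collection n) (𝓑′⊆bases : ∀ B → 𝓑′ B → IsBase r 𝓘 B) where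

  private
    𝓘′ : Collection n
    𝓘′ = restrictColl 𝓘 a 𝓑′

  restrictColl-⊆ : ∀ {I} → 𝓘′ I → 𝓘 I
  restrictColl-⊆ = proj₁

  isBase-restrictColl⁻ : ∀ {B} → IsBase r 𝓘′ B → IsBase r 𝓘 B
  isBase-restrictColl⁻ (B∈𝓘′ , size) = restrictColl-⊆ B∈𝓘′ , size

  interval-⊆-restrictColl : ∀ {B} → 𝓑′ B → IntervalIn 𝓘′ (B ─ a B) B
  interval-⊆-restrictColl {B} B∈𝓑′ Z l h =
    proj₂ (proj₁ activity B (𝓑′⊆bases B B∈𝓑′)) Z l h , B , B∈𝓑′ , l , h

  isBase-restrictColl⁺ : ∀ {B} → 𝓑′ B → IsBase r 𝓘′ B
  isBase-restrictColl⁺ {B} B∈𝓑′ =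
    interval-⊆-restrictColl B∈𝓑′ B (p─q⊆p B (a B)) ⊆-refl ,
    proj₂ (𝓑′⊆bases B B∈𝓑′)

  isBase-restrictColl⇒∈ : ∀ {B} → IsBase r 𝓘′ B → 𝓑′ B
  isBase-restrictColl⇒∈ {B} b′@((B∈𝓘 , B₀ , B₀∈𝓑′ , l , h) , _) =
    subst 𝓑′ (activity-interval-unique activity B∈𝓘
                (𝓑′⊆bases B₀ B₀∈𝓑′) l h
                (isBase-restrictColl⁻ b′) (p─q⊆p B (a B)) ⊆-refl)
             B₀∈𝓑′

  restrictColl-isCoveringSystem : IsCoveringSystem r 𝓘 → IsCoveringSystem r 𝓘′
  restrictColl-isCoveringSystem (bounded , _) =
    (λ I I∈𝓘′ → bounded I (restrictColl-⊆ I∈𝓘′)) ,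
    λ { I (_ , B , B∈𝓑′ , l , h) →
          B , isBase-restrictColl⁺ B∈𝓑′ , h ,
          λ Z I⊆Z Z⊆B → interval-⊆-restrictColl B∈𝓑′ Z (⊆-trans l I⊆Z) Z⊆B }

  restrictColl-isActivity : IsActivity r 𝓘′ a
  restrictColl-isActivity =
    (λ B b′ → proj₁ (proj₁ activity B (isBase-restrictColl⁻ b′)) ,
              interval-⊆-restrictColl (isBase-restrictColl⇒∈ b′)) ,
    λ { I (I∈𝓘 , B , B∈𝓑′ , l , h) →
          B , (isBase-restrictColl⁺ B∈𝓑′ , l , h) ,
          λ B′ b′ l′ h′ → activity-interval-unique activity I∈𝓘
                            (isBase-restrictColl⁻ b′) l′ h′ (𝓑′⊆bases B B∈𝓑′) l h }

proposition3p6 : (n r : ℕ) (𝓘 : Collection n) (a : Subset n → Subset n) →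
    IsCoveringSystem r 𝓘 → IsActivity r 𝓘 a →
    (𝓑′ : Collection n) → (∀ B → 𝓑′ B → IsBase r 𝓘 B) → ∃[ B ] 𝓑′ B →
    IsCoveringSystem r (restrictColl 𝓘 a 𝓑′) ×
    IsActivity r (restrictColl 𝓘 a 𝓑′) a
proposition3p6 n r 𝓘 a covering activity 𝓑′ 𝓑′⊆bases _ =
  restrictColl-isCoveringSystem activity 𝓑′ 𝓑′⊆bases covering ,
  restrictColl-isActivity activity 𝓑′ 𝓑′⊆bases
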